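{- Let $k\ge 1$ and $0\le r<k$ be integers, and let $n\ge 0$ be an integer. Let $$B_n(k,r,x)=\left(\binom{i-k+1+r}{i-j}x^k+\binom{i+1+r}{i-j+1}\right)_{i,j=0}^{n-1}.$$ Then $x^r\det B_n(k,r,x)=F^{(k)}_{kn+r}(x)$.
   Context: Binomial coefficients are generalized: for an integer $a$ (possibly negative) and an integer $m$, $\binom{a}{m}=\frac{a(a-1)\cdots(a-m+1)}{m!}$ if $m\ge 0$ and $\binom{a}{m}=0$ if $m<0$. For a positive integer $k$ and integer $N\ge 0$, the generalized Fibonacci polynomial is $F^{(k)}_N(x)=\sum_{j=0}^{\lfloor N/k\rfloor}\binom{N-(k-1)j}{j}x^{N-kj}$; equivalently $F^{(k)}_N(x)=x^N$ for $0\le N<k$ and $F^{(k)}_N(x)=xF^{(k)}_{N-1}(x)+F^{(k)}_{N-k}(x)$ for $N\ge k$. The determinant of a $0\times 0$ matrix is $1$. -}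

module Defs where

open import Level using (Level)
open import Data.Nat as ℕ using (ℕ; zero; suc; NonZero; _!)
open import Data.Nat.Properties using (_!≢0)
open import Data.Integer as ℤ using (ℤ; +_; -[1+_]; _/ℕ_)
open import Data.Fin using (Fin; zero; suc; punchIn; toℕ)
open import Algebra.Bundles using (CommutativeRing)

falling : ℤ → ℕ → ℤ
falling a zero    = + 1
falling a (suc m) = a ℤ.* falling (a ℤ.- + 1) m

-- Generalized binomial coefficient (a choose m) for integer a, m ≥ 0:
-- a(a-1)...(a-m+1) / m!  (the division is exact).
binom : ℤ → ℕ → ℤ
binom a m = _/ℕ_ (falling a m) (m !) {{m !≢0}}

binomℤ : ℤ → ℤ → ℤ
binomℤ a (+ m)    = binom a m
binomℤ a -[1+ m ] = + 0

module _ {c ℓ : Level} (R : CommutativeRing c ℓ) where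
  open CommutativeRing R using (Carrier; _≈_; _+_; _*_; -_; 0#; 1#)

  pow : Carrier → ℕ → Carrier
  pow x zero    = 1#
  pow x (suc n) = x * pow x n

  fromℕ : ℕ → Carrier
  fromℕ zero    = 0#
  fromℕ (suc n) = 1# + fromℕ n

  fromℤ : ℤ → Carrier
  fromℤ (+ n)    = fromℕ n
  fromℤ -[1+ n ] = - fromℕ (suc n)

  sumℕ : ℕ → (ℕ → Carrier) → Carrier
  sumℕ zero    f = 0#
  sumℕ (suc n) f = sumℕ n f + f n

  sumFin : (n : ℕ) → (Fin n → Carrier) → Carrier
  sumFin zero    f = 0#
  sumFin (suc n) f = f zero + sumFin n (λ j → f (suc j))

  sign : ℕ → Carrier
  sign zero    = 1#
  sign (suc j) = - sign j

  -- Determinant by Laplace (cofactor) expansion along the first row;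
  -- det of the 0×0 matrix is 1.
  det : (n : ℕ) → (Fin n → Fin n → Carrier) → Carrier
  det zero    M = 1#
  det (suc n) M =
    sumFin (suc n) (λ j → sign (toℕ j) * (M zero j * det n (λ a b → M (suc a) (punchIn j b))))

  fib : (k : ℕ) .{{_ : NonZero k}} → ℕ → Carrier → Carrier
  fib k N x = sumℕ (suc (N ℕ./ k)) (λ j →
    fromℤ (binom (+ N ℤ.- + ((k ℕ.∸ 1) ℕ.* j)) j) * pow x (N ℕ.∸ k ℕ.* j))

  Bmat : (k r n : ℕ) → Carrier → Fin n → Fin n → Carrier
  Bmat k r n x i j =
    fromℤ (binomℤ (+ toℕ i ℤ.- + k ℤ.+ + 1 ℤ.+ + r) (+ toℕ i ℤ.- + toℕ j)) * pow x k
    + fromℤ (binomℤ (+ toℕ i ℤ.+ + 1 ℤ.+ + r) (+ toℕ i ℤ.- + toℕ j ℤ.+ + 1))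

-- B_n(k,r,x) is lower Hessenberg with ones on the superdiagonal, so expanding along the first row
-- gives a first-column recursion for its trailing principal minors D_s(m) (rows and columns
-- s, …, s+m-1).  With y = x^k one shows by strong induction on m that
--   D_s(m) = Σ_q C((k-1)q + s + r + m, m - q) y^q.
-- In the inductive step, upper negation rewrites (-1)^j times the j-th first-column entry as
-- C(k-s-r-2, j) y - C(-s-r-1, j+1); the sum over j then collapses by two Chu-Vandermonde
-- convolutions and the leftover terms telescope.  At s = 0, multiplying by x^r and reversing the
-- order of summation gives F^{(k)}_{kn+r}(x).
module Submission where

open import Defs
open import Level using (Level)
open import Algebra.Bundles using (CommutativeRing)
open import Data.Nat as ℕ using (ℕ; zero; suc; _<_; _≤_; z≤n; s≤s; _∸_)
import Data.Nat.Properties as ℕₚ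
open import Data.Nat.Properties using (_!≢0)
import Data.Nat.DivMod as ℕ
import Data.Nat.Divisibility as ℕ∣
open import Data.Nat.Induction using (<-rec)
open import Data.Integer as ℤ using (ℤ; +_; -[1+_]; _⊖_; _/ℕ_)
import Data.Integer.Properties as ℤₚ
open import Data.Fin using (Fin; zero; suc; punchIn; toℕ)
open import Data.Maybe using (Maybe; just; nothing)
open import Relation.Nullary using (yes; no; contradiction)
open import Relation.Binary.PropositionalEquality as ≡ using (_≡_; _≢_)
open import Data.Sum using (inj₁; inj₂)
open import Function using (_∘_)

module RingFacts {c ℓ} (R : CommutativeRing c ℓ) where

  open CommutativeRing R hiding (zero)
  open import Relation.Binary.Reasoning.Setoid setoid
  open import Algebra.Properties.Ring ring using (-‿distribˡ-*; -‿distribʳ-*)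
  open import Algebra.Properties.AbelianGroup +-abelianGroup using (⁻¹-∙-comm)
  open import Algebra.Properties.Group +-group using (ε⁻¹≈ε; ⁻¹-involutive)
  open import Algebra.Properties.CommutativeSemigroup +-commutativeSemigroup using (interchange)
  import Algebra.Solver.Ring.AlmostCommutativeRing as ACR
  import Algebra.Solver.Ring

  fromℕ-+ : ∀ m n → fromℕ R (m ℕ.+ n) ≈ fromℕ R m + fromℕ R n
  fromℕ-+ zero    n = sym (+-identityˡ _)
  fromℕ-+ (suc m) n = trans (+-congˡ (fromℕ-+ m n)) (sym (+-assoc _ _ _))

  fromℕ-* : ∀ m n → fromℕ R (m ℕ.* n) ≈ fromℕ R m * fromℕ R n
  fromℕ-* zero    n = sym (zeroˡ _)
  fromℕ-* (suc m) n = begin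
    fromℕ R (n ℕ.+ m ℕ.* n)              ≈⟨ fromℕ-+ n (m ℕ.* n) ⟩
    fromℕ R n + fromℕ R (m ℕ.* n)        ≈⟨ +-congˡ (fromℕ-* m n) ⟩
    fromℕ R n + fromℕ R m * fromℕ R n    ≈⟨ +-congʳ (*-identityˡ _) ⟨
    1# * fromℕ R n + fromℕ R m * fromℕ R n ≈⟨ distribʳ _ _ _ ⟨
    (1# + fromℕ R m) * fromℕ R n         ∎

  fromℤ-⊖ : ∀ m n → fromℤ R (m ⊖ n) ≈ fromℕ R m - fromℕ R n
  fromℤ-⊖ zero    zero    = sym (-‿inverseʳ 0#)
  fromℤ-⊖ zero    (suc n) = sym (+-identityˡ _)
  fromℤ-⊖ (suc m) zero    = sym (trans (+-congˡ ε⁻¹≈ε) (+-identityʳ _))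
  fromℤ-⊖ (suc m) (suc n) = begin
    fromℤ R (suc m ⊖ suc n)                  ≡⟨ ≡.cong (fromℤ R) (ℤₚ.[1+m]⊖[1+n]≡m⊖n m n) ⟩
    fromℤ R (m ⊖ n)                          ≈⟨ fromℤ-⊖ m n ⟩
    fromℕ R m - fromℕ R n                    ≈⟨ +-identityˡ _ ⟨
    0# + (fromℕ R m - fromℕ R n)             ≈⟨ +-congʳ (-‿inverseʳ 1#) ⟨
    (1# - 1#) + (fromℕ R m - fromℕ R n)      ≈⟨ interchange _ _ _ _ ⟨
    fromℕ R (suc m) + (- 1# - fromℕ R n)     ≈⟨ +-congˡ (⁻¹-∙-comm 1# (fromℕ R n)) ⟩
    fromℕ R (suc m) - fromℕ R (suc n)        ∎

  fromℤ-+ : ∀ a b → fromℤ R (a ℤ.+ b) ≈ fromℤ R a + fromℤ R b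
  fromℤ-+ (+ m)    (+ n)    = fromℕ-+ m n
  fromℤ-+ (+ m)    -[1+ n ] = fromℤ-⊖ m (suc n)
  fromℤ-+ -[1+ m ] (+ n)    = trans (fromℤ-⊖ n (suc m)) (+-comm _ _)
  fromℤ-+ -[1+ m ] -[1+ n ] = begin
    - fromℕ R (suc (suc (m ℕ.+ n)))           ≡⟨ ≡.cong (λ t → - fromℕ R (suc t)) (ℕₚ.+-suc m n) ⟨
    - fromℕ R (suc m ℕ.+ suc n)               ≈⟨ -‿cong (fromℕ-+ (suc m) (suc n)) ⟩
    - (fromℕ R (suc m) + fromℕ R (suc n))     ≈⟨ ⁻¹-∙-comm _ _ ⟨
    - fromℕ R (suc m) + - fromℕ R (suc n)     ∎

  fromℤ-neg : ∀ a → fromℤ R (ℤ.- a) ≈ - fromℤ R a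
  fromℤ-neg (+ zero)  = sym ε⁻¹≈ε
  fromℤ-neg (+ suc n) = refl
  fromℤ-neg -[1+ n ]  = sym (⁻¹-involutive _)

  fromℤ-*-+ : ∀ a n → fromℤ R (a ℤ.* + n) ≈ fromℤ R a * fromℕ R n
  fromℤ-*-+ (+ m)    n = trans (reflexive (≡.cong (fromℤ R) (≡.sym (ℤₚ.pos-* m n)))) (fromℕ-* m n)
  fromℤ-*-+ -[1+ m ] n = begin
    fromℤ R (-[1+ m ] ℤ.* + n)            ≡⟨ ≡.cong (fromℤ R) (ℤₚ.neg-distribˡ-* (+ suc m) (+ n)) ⟨
    fromℤ R (ℤ.- (+ suc m ℤ.* + n))       ≈⟨ fromℤ-neg (+ suc m ℤ.* + n) ⟩
    - fromℤ R (+ suc m ℤ.* + n)           ≈⟨ -‿cong (fromℤ-*-+ (+ suc m) n) ⟩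
    - (fromℕ R (suc m) * fromℕ R n)       ≈⟨ -‿distribˡ-* _ _ ⟩
    - fromℕ R (suc m) * fromℕ R n         ∎

  fromℤ-* : ∀ a b → fromℤ R (a ℤ.* b) ≈ fromℤ R a * fromℤ R b
  fromℤ-* a (+ n)    = fromℤ-*-+ a n
  fromℤ-* a -[1+ n ] = begin
    fromℤ R (a ℤ.* -[1+ n ])              ≡⟨ ≡.cong (fromℤ R) (ℤₚ.neg-distribʳ-* a (+ suc n)) ⟨
    fromℤ R (ℤ.- (a ℤ.* + suc n))         ≈⟨ fromℤ-neg (a ℤ.* + suc n) ⟩
    - fromℤ R (a ℤ.* + suc n)             ≈⟨ -‿cong (fromℤ-*-+ a (suc n)) ⟩
    - (fromℤ R a * fromℕ R (suc n))       ≈⟨ -‿distribʳ-* _ _ ⟩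
    fromℤ R a * - fromℕ R (suc n)         ∎

  fromℤ-homomorphism : CommutativeRing.rawRing ℤₚ.+-*-commutativeRing
                         ACR.-Raw-AlmostCommutative⟶ ACR.fromCommutativeRing R
  fromℤ-homomorphism = record
    { ⟦_⟧    = fromℤ R
    ; +-homo = fromℤ-+
    ; *-homo = fromℤ-*
    ; -‿homo = fromℤ-neg
    ; 0-homo = refl
    ; 1-homo = +-identityʳ 1#
    }

  fromℤ-≟ : ∀ a b → Maybe (fromℤ R a ≈ fromℤ R b)
  fromℤ-≟ a b with a ℤ.≟ b
  ... | yes a≡b = just (reflexive (≡.cong (fromℤ R) a≡b))
  ... | no  _   = nothing

  module RingSolver = Algebra.Solver.Ring (CommutativeRing.rawRing ℤₚ.+-*-commutativeRing)
    (ACR.fromCommutativeRing R) fromℤ-homomorphism fromℤ-≟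
  open RingSolver using (solve; _:=_; _:+_; _:*_; _:-_)

  ∑ : ℕ → (ℕ → Carrier) → Carrier
  ∑ = sumℕ R

  ∑-cong-< : ∀ n {f g} → (∀ i → i < n → f i ≈ g i) → ∑ n f ≈ ∑ n g
  ∑-cong-< zero    eq = refl
  ∑-cong-< (suc n) eq = +-cong (∑-cong-< n (λ i i<n → eq i (ℕₚ.m<n⇒m<1+n i<n))) (eq n ℕₚ.≤-refl)

  ∑-cong : ∀ n {f g} → (∀ i → f i ≈ g i) → ∑ n f ≈ ∑ n g
  ∑-cong n eq = ∑-cong-< n (λ i _ → eq i)

  ∑-zero : ∀ n {f} → (∀ i → i < n → f i ≈ 0#) → ∑ n f ≈ 0#
  ∑-zero zero    eq = refl
  ∑-zero (suc n) eq =
    trans (+-cong (∑-zero n (λ i i<n → eq i (ℕₚ.m<n⇒m<1+n i<n))) (eq n ℕₚ.≤-refl)) (+-identityˡ 0#)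

  ∑-distrib-+ : ∀ n (f g : ℕ → Carrier) → ∑ n (λ i → f i + g i) ≈ ∑ n f + ∑ n g
  ∑-distrib-+ zero    f g = sym (+-identityˡ 0#)
  ∑-distrib-+ (suc n) f g = begin
    ∑ n (λ i → f i + g i) + (f n + g n) ≈⟨ +-congʳ (∑-distrib-+ n f g) ⟩
    (∑ n f + ∑ n g) + (f n + g n)       ≈⟨ interchange _ _ _ _ ⟩
    (∑ n f + f n) + (∑ n g + g n)       ∎

  -‿distrib-∑ : ∀ n (f : ℕ → Carrier) → - ∑ n f ≈ ∑ n (λ i → - f i)
  -‿distrib-∑ zero    f = ε⁻¹≈ε
  -‿distrib-∑ (suc n) f = trans (sym (⁻¹-∙-comm (∑ n f) (f n))) (+-congʳ (-‿distrib-∑ n f))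

  *-distribˡ-∑ : ∀ n a (f : ℕ → Carrier) → a * ∑ n f ≈ ∑ n (λ i → a * f i)
  *-distribˡ-∑ zero    a f = zeroʳ a
  *-distribˡ-∑ (suc n) a f = trans (distribˡ a (∑ n f) (f n)) (+-congʳ (*-distribˡ-∑ n a f))

  *-distribʳ-∑ : ∀ n a (f : ℕ → Carrier) → ∑ n f * a ≈ ∑ n (λ i → f i * a)
  *-distribʳ-∑ n a f =
    trans (*-comm (∑ n f) a) (trans (*-distribˡ-∑ n a f) (∑-cong n (λ i → *-comm a (f i))))

  ∑-shift : ∀ n (f : ℕ → Carrier) → ∑ (suc n) f ≈ f 0 + ∑ n (λ i → f (suc i))
  ∑-shift zero    f = +-comm 0# (f 0)
  ∑-shift (suc n) f = trans (+-congʳ (∑-shift n f)) (+-assoc _ _ _)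

  ∑-comm : ∀ n m (f : ℕ → ℕ → Carrier) →
           ∑ n (λ i → ∑ m (λ j → f i j)) ≈ ∑ m (λ j → ∑ n (λ i → f i j))
  ∑-comm zero    m f = sym (∑-zero m (λ _ _ → refl))
  ∑-comm (suc n) m f = trans (+-congʳ (∑-comm n m f)) (sym (∑-distrib-+ m _ _))

  ∑-reverse : ∀ n (f : ℕ → Carrier) → ∑ n f ≈ ∑ n (λ j → f (n ∸ suc j))
  ∑-reverse zero    f = refl
  ∑-reverse (suc n) f = begin
    ∑ n f + f n                                ≈⟨ +-congʳ (∑-reverse n f) ⟩
    ∑ n (λ j → f (n ∸ suc j)) + f n            ≈⟨ +-comm _ _ ⟩
    f (n ∸ 0) + ∑ n (λ j → f (n ∸ suc j))      ≈⟨ ∑-shift n (λ j → f (n ∸ j)) ⟨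
    ∑ (suc n) (λ j → f (n ∸ j))                ∎

  ∑-extend : ∀ m M f → m ≤ M → (∀ i → m ≤ i → f i ≈ 0#) → ∑ M f ≈ ∑ m f
  ∑-extend m M f m≤M vanish = begin
    ∑ M f             ≡⟨ ≡.cong (λ t → ∑ t f) (ℕₚ.m+[n∸m]≡n m≤M) ⟨
    ∑ (m ℕ.+ (M ∸ m)) f ≈⟨ go (M ∸ m) ⟩
    ∑ m f             ∎
    where
    go : ∀ t → ∑ (m ℕ.+ t) f ≈ ∑ m f
    go zero    = reflexive (≡.cong (λ t → ∑ t f) (ℕₚ.+-identityʳ m))
    go (suc t) = begin
      ∑ (m ℕ.+ suc t) f           ≡⟨ ≡.cong (λ t → ∑ t f) (ℕₚ.+-suc m t) ⟩
      ∑ (m ℕ.+ t) f + f (m ℕ.+ t) ≈⟨ +-cong (go t) (vanish (m ℕ.+ t) (ℕₚ.m≤m+n m t)) ⟩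
      ∑ m f + 0#                  ≈⟨ +-identityʳ _ ⟩
      ∑ m f                       ∎

  ∑-distrib-- : ∀ n (f g : ℕ → Carrier) → ∑ n (λ i → f i - g i) ≈ ∑ n f - ∑ n g
  ∑-distrib-- n f g = trans (∑-distrib-+ n f (λ i → - g i)) (+-congˡ (sym (-‿distrib-∑ n g)))

  fromℤ-∑ : ∀ n (f : ℕ → ℤ) → fromℤ R (sumℕ ℤₚ.+-*-commutativeRing n f) ≈ ∑ n (λ i → fromℤ R (f i))
  fromℤ-∑ zero    f = refl
  fromℤ-∑ (suc n) f = trans (fromℤ-+ (sumℕ ℤₚ.+-*-commutativeRing n f) (f n)) (+-congʳ (fromℤ-∑ n f))

  fromℤ-sign : ∀ j → sign R j ≈ fromℤ R (sign ℤₚ.+-*-commutativeRing j)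
  fromℤ-sign zero    = sym (+-identityʳ 1#)
  fromℤ-sign (suc j) = trans (-‿cong (fromℤ-sign j)) (sym (fromℤ-neg (sign ℤₚ.+-*-commutativeRing j)))

  ∑-telescope : ∀ n (a : ℕ → Carrier) → ∑ n (λ i → a (suc i) - a i) ≈ a n - a 0
  ∑-telescope zero    a = sym (-‿inverseʳ (a 0))
  ∑-telescope (suc n) a = begin
    ∑ n (λ i → a (suc i) - a i) + (a (suc n) - a n) ≈⟨ +-congʳ (∑-telescope n a) ⟩
    (a n - a 0) + (a (suc n) - a n)
      ≈⟨ solve 3 (λ aₙ a₀ a₁₊ₙ → (aₙ :- a₀) :+ (a₁₊ₙ :- aₙ) := a₁₊ₙ :- a₀) refl (a n) (a 0) (a (suc n)) ⟩
    a (suc n) - a 0                                 ∎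

  pow-+ : ∀ x a b → pow R x (a ℕ.+ b) ≈ pow R x a * pow R x b
  pow-+ x zero    b = sym (*-identityˡ _)
  pow-+ x (suc a) b = trans (*-congˡ (pow-+ x a b)) (sym (*-assoc _ _ _))

  pow-* : ∀ x a b → pow R x (a ℕ.* b) ≈ pow R (pow R x a) b
  pow-* x a zero    = reflexive (≡.cong (pow R x) (ℕₚ.*-zeroʳ a))
  pow-* x a (suc b) = begin
    pow R x (a ℕ.* suc b)          ≡⟨ ≡.cong (pow R x) (ℕₚ.*-suc a b) ⟩
    pow R x (a ℕ.+ a ℕ.* b)        ≈⟨ pow-+ x a (a ℕ.* b) ⟩
    pow R x a * pow R x (a ℕ.* b)  ≈⟨ *-congˡ (pow-* x a b) ⟩
    pow R x a * pow R (pow R x a) b ∎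

  sumFin-cong : ∀ n {f g : Fin n → Carrier} → (∀ j → f j ≈ g j) → sumFin R n f ≈ sumFin R n g
  sumFin-cong zero    eq = refl
  sumFin-cong (suc n) eq = +-cong (eq zero) (sumFin-cong n (λ j → eq (suc j)))

  sumFin-zero : ∀ n {f : Fin n → Carrier} → (∀ j → f j ≈ 0#) → sumFin R n f ≈ 0#
  sumFin-zero zero    eq = refl
  sumFin-zero (suc n) eq = trans (+-cong (eq zero) (sumFin-zero n (λ j → eq (suc j)))) (+-identityˡ 0#)

  det-cong : ∀ n {M N : Fin n → Fin n → Carrier} → (∀ a b → M a b ≈ N a b) → det R n M ≈ det R n N
  det-cong zero    eq = refl
  det-cong (suc n) eq = sumFin-cong (suc n) (λ j →
    *-congˡ {sign R (toℕ j)} (*-cong (eq zero j) (det-cong n (λ a b → eq (suc a) (punchIn j b)))))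


module Hessenberg {c ℓ} (R : CommutativeRing c ℓ)
  (h : ℕ → ℕ → CommutativeRing.Carrier R)
  (h-superdiagonal : ∀ i → CommutativeRing._≈_ R (h i (suc i)) (CommutativeRing.1# R))
  (h-above : ∀ i t → CommutativeRing._≈_ R (h i (i ℕ.+ suc (suc t))) (CommutativeRing.0# R))
  where

  open CommutativeRing R hiding (zero)
  open RingFacts R
  open import Algebra.Properties.Ring ring using (-1*x≈-x; -‿distribˡ-*)
  open import Relation.Binary.Reasoning.Setoid setoid

  minor : ℕ → (m : ℕ) → Fin m → Fin m → Carrier
  minor s m a b = h (s ℕ.+ toℕ a) (s ℕ.+ toℕ b)

  minorDet : ℕ → ℕ → Carrier
  minorDet s m = det R m (minor s m)

  withFirstColumn : ℕ → (ℕ → Carrier) → ℕ → ℕ → Carrier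
  withFirstColumn s v i zero    = v i
  withFirstColumn s v i (suc b) = h i (s ℕ.+ suc b)

  h-cong : ∀ {i i′ j j′} → i ≡ i′ → j ≡ j′ → h i j ≈ h i′ j′
  h-cong ≡.refl ≡.refl = refl

  -- Deleting the second column of such a matrix leaves one of the same shape, one row further down;
  -- this is why the first column is generalised.
  det-withFirstColumn : ∀ m s v (M : Fin (suc m) → Fin (suc m) → Carrier) →
    (∀ a b → M a b ≈ withFirstColumn s v (s ℕ.+ toℕ a) (toℕ b)) →
    det R (suc m) M ≈
    ∑ (suc m) (λ j → sign R j * (v (s ℕ.+ j) * minorDet (suc (s ℕ.+ j)) (m ∸ j)))
  det-withFirstColumn zero s v M M≈ = begin
    1# * (M zero zero * 1#) + 0#        ≈⟨ +-congʳ (*-congˡ (*-congʳ (M≈ zero zero))) ⟩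
    1# * (v (s ℕ.+ 0) * 1#) + 0#        ≈⟨ +-comm _ _ ⟩
    0# + 1# * (v (s ℕ.+ 0) * 1#)        ∎
  det-withFirstColumn (suc m) s v M M≈ = begin
    F zero + (F (suc zero) + sumFin R m (λ j → F (suc (suc j))))
      ≈⟨ +-cong first (+-cong second (sumFin-zero m rest)) ⟩
    f 0 + (∑ (suc m) (λ j → f (suc j)) + 0#)   ≈⟨ +-congˡ (+-identityʳ _) ⟩
    f 0 + ∑ (suc m) (λ j → f (suc j))          ≈⟨ ∑-shift (suc m) f ⟨
    ∑ (suc (suc m)) f                          ∎
    where
    f : ℕ → Carrier
    f j = sign R j * (v (s ℕ.+ j) * minorDet (suc (s ℕ.+ j)) (suc m ∸ j))
    F : Fin (suc (suc m)) → Carrier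
    F j = sign R (toℕ j) * (M zero j * det R (suc m) (λ a b → M (suc a) (punchIn j b)))
    s+0≡s = ℕₚ.+-identityʳ s
    first : F zero ≈ f 0
    first = begin
      1# * (M zero zero * det R (suc m) (λ a b → M (suc a) (suc b)))
        ≈⟨ *-congˡ (*-cong (M≈ zero zero) (det-cong (suc m) (λ a b →
             trans (M≈ (suc a) (suc b)) (h-cong (ℕₚ.+-suc s (toℕ a)) (ℕₚ.+-suc s (toℕ b)))))) ⟩
      1# * (v (s ℕ.+ 0) * minorDet (suc s) (suc m))
        ≡⟨ ≡.cong (λ t → 1# * (v (s ℕ.+ 0) * minorDet (suc t) (suc m))) s+0≡s ⟨
      f 0 ∎
    minor₁≈withFirstColumn : ∀ a b →
      M (suc a) (punchIn (suc zero) b) ≈ withFirstColumn (suc s) v (suc s ℕ.+ toℕ a) (toℕ b)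
    minor₁≈withFirstColumn a zero    = trans (M≈ (suc a) zero) (reflexive (≡.cong v (ℕₚ.+-suc s (toℕ a))))
    minor₁≈withFirstColumn a (suc b) =
      trans (M≈ (suc a) (suc (suc b))) (h-cong (ℕₚ.+-suc s (toℕ a)) (ℕₚ.+-suc s (suc (toℕ b))))
    second : F (suc zero) ≈ ∑ (suc m) (λ j → f (suc j))
    second = begin
      - 1# * (M zero (suc zero) * det R (suc m) (λ a b → M (suc a) (punchIn (suc zero) b)))
        ≈⟨ *-congˡ (*-cong (trans (M≈ zero (suc zero))
                                  (trans (h-cong s+0≡s (ℕₚ.+-comm s 1)) (h-superdiagonal s)))
                           (det-withFirstColumn m (suc s) v _ minor₁≈withFirstColumn)) ⟩
      - 1# * (1# * ∑ (suc m) g)   ≈⟨ trans (-1*x≈-x _) (-‿cong (*-identityˡ _)) ⟩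
      - ∑ (suc m) g               ≈⟨ -‿distrib-∑ (suc m) g ⟩
      ∑ (suc m) (λ j → - g j)     ≈⟨ ∑-cong (suc m) (λ j → trans (-‿distribˡ-* _ _) (reflexive
                                       (≡.cong (λ t → - sign R j * (v t * minorDet (suc t) (m ∸ j)))
                                               (≡.sym (ℕₚ.+-suc s j))))) ⟩
      ∑ (suc m) (λ j → f (suc j)) ∎
      where
      g : ℕ → Carrier
      g j = sign R j * (v (suc s ℕ.+ j) * minorDet (suc (suc s ℕ.+ j)) (m ∸ j))
    rest : ∀ j → F (suc (suc j)) ≈ 0#
    rest j = begin
      sign R (toℕ (suc (suc j))) * (M zero (suc (suc j)) * _)
        ≈⟨ *-congˡ (*-congʳ (trans (M≈ zero (suc (suc j)))
                                   (trans (h-cong s+0≡s ≡.refl) (h-above s (toℕ j))))) ⟩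
      sign R (toℕ (suc (suc j))) * (0# * _)  ≈⟨ trans (*-congˡ (zeroˡ _)) (zeroʳ _) ⟩
      0# ∎

  det-minor-expansion : ∀ m s → minorDet s (suc m) ≈
    ∑ (suc m) (λ j → sign R j * (h (s ℕ.+ j) s * minorDet (suc (s ℕ.+ j)) (m ∸ j)))
  det-minor-expansion m s = det-withFirstColumn m s (λ i → h i s) (minor s (suc m)) minor≈withFirstColumn
    where
    minor≈withFirstColumn : ∀ a b →
      minor s (suc m) a b ≈ withFirstColumn s (λ i → h i s) (s ℕ.+ toℕ a) (toℕ b)
    minor≈withFirstColumn a zero    = h-cong ≡.refl (ℕₚ.+-identityʳ s)
    minor≈withFirstColumn a (suc b) = refl


module Binomial where

  open import Data.Integer using (_+_; _*_; _-_; -_)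
  open import Data.Nat using (_!)
  open ≡ using (cong; cong₂; sym; trans)
  open ≡.≡-Reasoning
  open import Data.Integer.Tactic.RingSolver using (solve-∀)

  falling-suc : ∀ a m → falling a (suc m) ≡ falling a m * (a - + m)
  falling-suc a zero    = lemma a
    where lemma : ∀ a → a * + 1 ≡ + 1 * (a - + 0)
          lemma = solve-∀
  falling-suc a (suc m) = begin
    a * falling (a - + 1) (suc m)                   ≡⟨ cong (a *_) (falling-suc (a - + 1) m) ⟩
    a * (falling (a - + 1) m * ((a - + 1) - + m))   ≡⟨ lemma a (falling (a - + 1) m) (+ m) ⟩
    a * falling (a - + 1) m * (a - + suc m)         ∎
    where lemma : ∀ a F m → a * (F * ((a - + 1) - m)) ≡ a * F * (a - (+ 1 + m))
          lemma = solve-∀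

  falling-pascal : ∀ a m → falling (a + + 1) (suc m) ≡ falling a (suc m) + + suc m * falling a m
  falling-pascal a m = begin
    (a + + 1) * falling ((a + + 1) - + 1) m           ≡⟨ cong (λ b → (a + + 1) * falling b m) (cancel a) ⟩
    (a + + 1) * falling a m                           ≡⟨ lemma a (falling a m) (+ m) ⟩
    falling a m * (a - + m) + + suc m * falling a m   ≡⟨ cong (_+ + suc m * falling a m) (falling-suc a m) ⟨
    falling a (suc m) + + suc m * falling a m         ∎
    where cancel : ∀ a → (a + + 1) - + 1 ≡ a
          cancel = solve-∀
          lemma : ∀ a F m → (a + + 1) * F ≡ F * (a - m) + (+ 1 + m) * F
          lemma = solve-∀

  -- Pascal's rule as a definition; it exhibits falling a m as a multiple of m!, so binom is exact.
  choose⁺ : ℕ → ℕ → ℤ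
  choose⁺ n       zero    = + 1
  choose⁺ zero    (suc m) = + 0
  choose⁺ (suc n) (suc m) = choose⁺ n (suc m) + choose⁺ n m

  choose⁻ : ℕ → ℕ → ℤ
  choose⁻ n       zero    = + 1
  choose⁻ zero    (suc m) = + 0 - choose⁻ zero m
  choose⁻ (suc n) (suc m) = choose⁻ n (suc m) - choose⁻ (suc n) m

  choose : ℤ → ℕ → ℤ
  choose (+ n)    = choose⁺ n
  choose -[1+ n ] = choose⁻ n

  choose-pascal : ∀ a m → choose (a + + 1) (suc m) ≡ choose a (suc m) + choose a m
  choose-pascal (+ n)          m rewrite ℕₚ.+-comm n 1 = ≡.refl
  choose-pascal -[1+ zero ]    m = lemma (choose⁻ 0 m)
    where lemma : ∀ c → + 0 ≡ (+ 0 - c) + c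
          lemma = solve-∀
  choose-pascal -[1+ suc n ]   m = lemma (choose⁻ n (suc m)) (choose⁻ (suc n) m)
    where lemma : ∀ a c → a ≡ (a - c) + c
          lemma = solve-∀

  falling≡choose*! : ∀ m a → falling a m ≡ choose a m * + (m !)
  falling≡choose*! zero    (+ n)    = ≡.refl
  falling≡choose*! zero    -[1+ n ] = ≡.refl
  falling≡choose*! (suc m) a        = ℤₚ.i-j≡0⇒i≡j _ _ (defect≡0 a)
    where
    defect : ℤ → ℤ
    defect a = falling a (suc m) - choose a (suc m) * + (suc m !)
    defect-step : ∀ a → defect (a + + 1) ≡ defect a
    defect-step a = begin
      falling (a + + 1) (suc m) - choose (a + + 1) (suc m) * + (suc m !)
        ≡⟨ cong₂ (λ u v → u - v * + (suc m !)) (falling-pascal a m) (choose-pascal a m) ⟩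
      falling a (suc m) + + suc m * falling a m - (choose a (suc m) + choose a m) * + (suc m !)
        ≡⟨ cong₂ (λ u v → falling a (suc m) + + suc m * u - (choose a (suc m) + choose a m) * v)
                 (falling≡choose*! m a) (ℤₚ.pos-* (suc m) (m !)) ⟩
      falling a (suc m) + + suc m * (choose a m * + (m !))
        - (choose a (suc m) + choose a m) * (+ suc m * + (m !))
        ≡⟨ lemma (falling a (suc m)) (choose a (suc m)) (choose a m) (+ suc m) (+ (m !)) ⟩
      falling a (suc m) - choose a (suc m) * (+ suc m * + (m !))
        ≡⟨ cong (λ v → falling a (suc m) - choose a (suc m) * v) (ℤₚ.pos-* (suc m) (m !)) ⟨
      defect a ∎
      where lemma : ∀ F c d s f → F + s * (d * f) - (c + d) * (s * f) ≡ F - c * (s * f)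
            lemma = solve-∀
    -- By Pascal's rule on both sides and the claim for m, the defect is invariant under a ↦ a + 1.
    defect≡0 : ∀ a → defect a ≡ + 0
    defect≡0 (+ zero)         = ≡.refl
    defect≡0 (+ suc n)        = trans (cong (λ n → defect (+ n)) (ℕₚ.+-comm 1 n))
                                      (trans (defect-step (+ n)) (defect≡0 (+ n)))
    defect≡0 -[1+ zero ]      = trans (sym (defect-step -[1+ 0 ])) (defect≡0 (+ 0))
    defect≡0 -[1+ suc n ]     = trans (sym (defect-step -[1+ suc n ])) (defect≡0 -[1+ n ])

  i*n/ℕn≡i : ∀ i n .{{_ : ℕ.NonZero n}} → (i * + n) /ℕ n ≡ i
  i*n/ℕn≡i (+ m)    n       = trans (cong (_/ℕ n) (sym (ℤₚ.pos-* m n))) (cong +_ (ℕ.m*n/n≡m m n))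
  i*n/ℕn≡i -[1+ m ] (suc n) with suc (n ℕ.+ m ℕ.* suc n) ℕ.% suc n in eq
  ... | zero  = cong (λ t → - (+ t)) (ℕ.m*n/n≡m (suc m) (suc n))
  ... | suc r with () ← trans (sym eq) (ℕ.m*n%n≡0 (suc m) (suc n))

  binom≡choose : ∀ a m → binom a m ≡ choose a m
  binom≡choose a m = trans (cong (λ t → (t /ℕ (m !)) {{m !≢0}}) (falling≡choose*! m a))
                           (i*n/ℕn≡i (choose a m) (m !) {{m !≢0}})

  binom-pascal : ∀ a m → binom (a + + 1) (suc m) ≡ binom a (suc m) + binom a m
  binom-pascal a m rewrite binom≡choose (a + + 1) (suc m) | binom≡choose a (suc m) | binom≡choose a m =
    choose-pascal a m

  binomℤ-pascal : ∀ a t → binomℤ (a + + 1) t ≡ binomℤ a t + binomℤ a (t - + 1)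
  binomℤ-pascal a (+ zero)  = ≡.refl
  binomℤ-pascal a (+ suc t) = binom-pascal a t
  binomℤ-pascal a -[1+ t ]  = ≡.refl

  binom-< : ∀ n m → n ℕ.< m → binom (+ n) m ≡ + 0
  binom-< n m n<m = trans (binom≡choose (+ n) m) (choose⁺-< n m n<m)
    where
    choose⁺-< : ∀ n m → n ℕ.< m → choose⁺ n m ≡ + 0
    choose⁺-< zero    (suc m)       _           = ≡.refl
    choose⁺-< (suc n) (suc (suc m)) (s≤s n<1+m) =
      cong₂ _+_ (choose⁺-< n (suc (suc m)) (ℕₚ.m<n⇒m<1+n n<1+m)) (choose⁺-< n (suc m) n<1+m)

  signℤ : ℕ → ℤ
  signℤ = sign ℤₚ.+-*-commutativeRing

  falling-negate : ∀ a j → signℤ j * falling (a + + j) j ≡ falling (- a - + 1) j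
  falling-negate a zero    = ≡.refl
  falling-negate a (suc j) = begin
    - signℤ j * ((a + + suc j) * falling ((a + + suc j) - + 1) j)
      ≡⟨ cong (λ b → - signℤ j * ((a + + suc j) * falling b j)) (cancel a (+ j)) ⟩
    - signℤ j * ((a + + suc j) * falling (a + + j) j)
      ≡⟨ reorder (signℤ j) (a + + suc j) (falling (a + + j) j) ⟩
    - (a + + suc j) * (signℤ j * falling (a + + j) j)
      ≡⟨ cong (- (a + + suc j) *_) (falling-negate a j) ⟩
    - (a + + suc j) * falling (- a - + 1) j
      ≡⟨ negate a (+ j) (falling (- a - + 1) j) ⟩
    falling (- a - + 1) j * ((- a - + 1) - + j)
      ≡⟨ falling-suc (- a - + 1) j ⟨
    falling (- a - + 1) (suc j) ∎
    where cancel : ∀ a j → (a + (+ 1 + j)) - + 1 ≡ a + j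
          cancel = solve-∀
          reorder : ∀ s b F → - s * (b * F) ≡ - b * (s * F)
          reorder = solve-∀
          negate : ∀ a j F → - (a + (+ 1 + j)) * F ≡ F * ((- a - + 1) - j)
          negate = solve-∀

  binom-negate : ∀ a j → signℤ j * binom (a + + j) j ≡ binom (- a - + 1) j
  binom-negate a j rewrite binom≡choose (a + + j) j | binom≡choose (- a - + 1) j =
    ℤₚ.*-cancelʳ-≡ _ _ (+ (j !)) {{j !≢0}} (begin
      signℤ j * choose (a + + j) j * + (j !)    ≡⟨ ℤₚ.*-assoc (signℤ j) _ _ ⟩
      signℤ j * (choose (a + + j) j * + (j !))  ≡⟨ cong (signℤ j *_) (falling≡choose*! j (a + + j)) ⟨
      signℤ j * falling (a + + j) j             ≡⟨ falling-negate a j ⟩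
      falling (- a - + 1) j                     ≡⟨ falling≡choose*! j (- a - + 1) ⟩
      choose (- a - + 1) j * + (j !)            ∎)

  open RingFacts ℤₚ.+-*-commutativeRing using (∑; ∑-zero; ∑-cong; ∑-distrib-+)

  binomℤ-0 : ∀ t → t ≢ + 0 → binomℤ (+ 0) t ≡ + 0
  binomℤ-0 (+ zero)  t≢0 = contradiction ≡.refl t≢0
  binomℤ-0 (+ suc t) _   = binom-< 0 (suc t) (s≤s z≤n)
  binomℤ-0 -[1+ t ]  _   = ≡.refl

  binomℤ-0-⊖ : ∀ {i n} → i ≢ n → binomℤ (+ 0) (+ n - + i) ≡ + 0
  binomℤ-0-⊖ i≢n = binomℤ-0 _ (λ eq → i≢n (ℤₚ.+-injective (sym (ℤₚ.i-j≡0⇒i≡j _ _ eq))))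

  ∑-δ : ∀ J n (f : ℕ → ℤ) → n ℕ.< J → ∑ J (λ i → f i * binomℤ (+ 0) (+ n - + i)) ≡ f n
  ∑-δ (suc J) n f (s≤s n≤J) with ℕₚ.m≤n⇒m<n∨m≡n n≤J
  ... | inj₁ n<J    = begin
    ∑ J (λ i → f i * binomℤ (+ 0) (+ n - + i)) + f J * binomℤ (+ 0) (+ n - + J)
      ≡⟨ cong₂ _+_ (∑-δ J n f n<J) (cong (f J *_) (binomℤ-0-⊖ (ℕₚ.<⇒≢ n<J ∘ sym))) ⟩
    f n + f J * + 0 ≡⟨ cong (_+_ (f n)) (ℤₚ.*-zeroʳ (f J)) ⟩
    f n + + 0 ≡⟨ ℤₚ.+-identityʳ (f n) ⟩
    f n       ∎
  ... | inj₂ ≡.refl = begin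
    ∑ J (λ i → f i * binomℤ (+ 0) (+ J - + i)) + f J * binomℤ (+ 0) (+ J - + J)
      ≡⟨ cong₂ _+_ (∑-zero J (λ i i<J → trans (cong (f i *_) (binomℤ-0-⊖ (ℕₚ.<⇒≢ i<J))) (ℤₚ.*-zeroʳ (f i))))
                   (cong (λ t → f J * binomℤ (+ 0) t) (ℤₚ.+-inverseʳ (+ J))) ⟩
    + 0 + f J * + 1 ≡⟨ trans (ℤₚ.+-identityˡ _) (ℤₚ.*-identityʳ (f J)) ⟩
    f J             ∎

  vandermonde : ∀ β α J n → n ℤ.< + J →
    ∑ J (λ i → binom α i * binomℤ (+ β) (n - + i)) ≡ binomℤ (α + + β) n
  vandermonde zero    α J (+ n)    n<J rewrite ℤₚ.+-identityʳ α = ∑-δ J n (binom α) (ℤₚ.drop‿+<+ n<J)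
  vandermonde zero    α J -[1+ n ] _   =
    ∑-zero J (λ i _ → trans (cong (binom α i *_) (negative i)) (ℤₚ.*-zeroʳ (binom α i)))
    where negative : ∀ i → binomℤ (+ 0) (-[1+ n ] - + i) ≡ + 0
          negative zero    = ≡.refl
          negative (suc i) = ≡.refl
  vandermonde (suc β) α J n n<J = begin
    ∑ J (λ i → binom α i * binomℤ (+ suc β) (n - + i))
      ≡⟨ ∑-cong J split ⟩
    ∑ J (λ i → binom α i * binomℤ (+ β) (n - + i) + binom α i * binomℤ (+ β) ((n - + 1) - + i))
      ≡⟨ ∑-distrib-+ J _ _ ⟩
    ∑ J (λ i → binom α i * binomℤ (+ β) (n - + i)) + ∑ J (λ i → binom α i * binomℤ (+ β) ((n - + 1) - + i))
      ≡⟨ cong₂ _+_ (vandermonde β α J n n<J)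
                   (vandermonde β α J (n - + 1) (ℤₚ.≤-<-trans (ℤₚ.i-j≤i n (+ 1)) n<J)) ⟩
    binomℤ (α + + β) n + binomℤ (α + + β) (n - + 1)
      ≡⟨ binomℤ-pascal (α + + β) n ⟨
    binomℤ ((α + + β) + + 1) n
      ≡⟨ cong (λ a → binomℤ a n) (assoc α (+ β)) ⟩
    binomℤ (α + + suc β) n ∎
    where
    assoc : ∀ a b → (a + b) + + 1 ≡ a + (+ 1 + b)
    assoc = solve-∀
    swap : ∀ n i → (n - i) - + 1 ≡ (n - + 1) - i
    swap = solve-∀
    split : ∀ i → binom α i * binomℤ (+ suc β) (n - + i) ≡
                  binom α i * binomℤ (+ β) (n - + i) + binom α i * binomℤ (+ β) ((n - + 1) - + i)
    split i = begin
      binom α i * binomℤ (+ suc β) (n - + i)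
        ≡⟨ cong (λ b → binom α i * binomℤ b (n - + i)) (cong +_ (ℕₚ.+-comm 1 β)) ⟩
      binom α i * binomℤ (+ β + + 1) (n - + i)
        ≡⟨ cong (binom α i *_) (binomℤ-pascal (+ β) (n - + i)) ⟩
      binom α i * (binomℤ (+ β) (n - + i) + binomℤ (+ β) ((n - + i) - + 1))
        ≡⟨ cong (λ t → binom α i * (binomℤ (+ β) (n - + i) + binomℤ (+ β) t)) (swap n (+ i)) ⟩
      binom α i * (binomℤ (+ β) (n - + i) + binomℤ (+ β) ((n - + 1) - + i))
        ≡⟨ ℤₚ.*-distribˡ-+ (binom α i) _ _ ⟩
      binom α i * binomℤ (+ β) (n - + i) + binom α i * binomℤ (+ β) ((n - + 1) - + i) ∎


module Coefficients (k₋₁ : ℕ) where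

  open import Data.Integer using (_+_; _*_; _-_; -_)
  open ≡ using (cong; cong₂; sym; trans)
  open ≡.≡-Reasoning
  open import Data.Integer.Tactic.RingSolver using (solve-∀)
  open import Data.Nat.Tactic.RingSolver using () renaming (solve-∀ to ℕsolve-∀)
  open Binomial using (binom-negate; binom-<; vandermonde; signℤ)
  open RingFacts ℤₚ.+-*-commutativeRing using (∑; ∑-cong; ∑-shift)

  k : ℕ
  k = suc k₋₁

  +m-+n≡+[m∸n] : ∀ {m n} → n ≤ m → + m - + n ≡ + (m ∸ n)
  +m-+n≡+[m∸n] {m} {n} n≤m = trans (ℤₚ.[+m]-[+n]≡m⊖n m n) (ℤₚ.⊖-≥ n≤m)

  +[m+n]-+m≡+n : ∀ m n → + (m ℕ.+ n) - + m ≡ + n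
  +[m+n]-+m≡+n m n = trans (+m-+n≡+[m∸n] (ℕₚ.m≤m+n m n)) (cong +_ (ℕₚ.m+n∸m≡n m n))

  +m-+[m+1+n]≡-[1+n] : ∀ m n → + m - + (m ℕ.+ suc n) ≡ -[1+ n ]
  +m-+[m+1+n]≡-[1+n] m n = trans (ℤₚ.[+m]-[+n]≡m⊖n m (m ℕ.+ suc n))
    (trans (ℤₚ.⊖-< (ℕₚ.m<m+n m (s≤s z≤n))) (cong (λ t → - (+ t)) (ℕₚ.m+n∸m≡n m (suc n))))

  binomℤ-+m-+n : ∀ a {m n} → m < n → binomℤ a (+ m - + n) ≡ + 0
  binomℤ-+m-+n a {m} {suc n} (s≤s m≤n) = cong (binomℤ a) (trans (ℤₚ.[+m]-[+n]≡m⊖n m (suc n))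
    (trans (ℤₚ.⊖-< (s≤s m≤n)) (cong (λ t → - + t) (ℕₚ.+-∸-assoc 1 m≤n))))

  coeff : ℕ → ℕ → ℕ → ℤ
  coeff A m q = binomℤ (+ (k₋₁ ℕ.* q ℕ.+ A ℕ.+ m)) (+ m - + q)

  α₁ α₂ : ℕ → ℤ
  α₁ A = - (+ A + + 1 - + k) - + 1
  α₂ A = - + A - + 1

  sign*binom-entry₁ : ∀ r s j → signℤ j * binom (+ (s ℕ.+ j) - + k + + 1 + + r) j ≡ binom (α₁ (s ℕ.+ r)) j
  sign*binom-entry₁ r s j =
    trans (cong (λ a → signℤ j * binom a j) upper) (binom-negate (+ (s ℕ.+ r) + + 1 - + k) j)
    where
    lemma : ∀ s j k r → s + j - k + + 1 + r ≡ (s + r + + 1 - k) + j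
    lemma = solve-∀
    upper : + (s ℕ.+ j) - + k + + 1 + + r ≡ (+ (s ℕ.+ r) + + 1 - + k) + + j
    upper rewrite ℤₚ.pos-+ s j | ℤₚ.pos-+ s r = lemma (+ s) (+ j) (+ k) (+ r)

  sign*binom-entry₂ : ∀ r s j →
    signℤ j * binom (+ (s ℕ.+ j) + + 1 + + r) (suc j) ≡ - binom (α₂ (s ℕ.+ r)) (suc j)
  sign*binom-entry₂ r s j = begin
    signℤ j * b                                                ≡⟨ double-negation (signℤ j) b ⟩
    - (- signℤ j * b)                                          ≡⟨ cong (λ a → - (- signℤ j * binom a (suc j))) upper ⟩
    - (signℤ (suc j) * binom (+ (s ℕ.+ r) + + suc j) (suc j))  ≡⟨ cong -_ (binom-negate (+ (s ℕ.+ r)) (suc j)) ⟩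
    - binom (α₂ (s ℕ.+ r)) (suc j)                             ∎
    where
    b = binom (+ (s ℕ.+ j) + + 1 + + r) (suc j)
    double-negation : ∀ σ b → σ * b ≡ - (- σ * b)
    double-negation = solve-∀
    lemma : ∀ s j r → s + j + + 1 + r ≡ s + r + (+ 1 + j)
    lemma = solve-∀
    upper : + (s ℕ.+ j) + + 1 + + r ≡ + (s ℕ.+ r) + + suc j
    upper rewrite ℤₚ.pos-+ s j | ℤₚ.pos-+ s r = lemma (+ s) (+ j) (+ r)

  N : ℕ → ℕ → ℕ → ℕ
  N A m q = k₋₁ ℕ.* q ℕ.+ A ℕ.+ suc m

  +N : ∀ A m q → + N A m q ≡ + k₋₁ * + q + + A + (+ 1 + + m)
  +N A m q = trans (ℤₚ.pos-+ (k₋₁ ℕ.* q ℕ.+ A) (suc m))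
    (cong (_+ + suc m) (trans (ℤₚ.pos-+ (k₋₁ ℕ.* q) A) (cong (_+ + A) (ℤₚ.pos-* k₋₁ q))))

  coeff-shift : ∀ A m j q → j ≤ m → coeff (A ℕ.+ suc j) (m ∸ j) q ≡ binomℤ (+ N A m q) ((+ m - + q) - + j)
  coeff-shift A m j q j≤m = cong₂ binomℤ (cong +_ upper) lower
    where
    lemma : ∀ a b j t → a ℕ.+ (b ℕ.+ suc j) ℕ.+ t ≡ a ℕ.+ b ℕ.+ suc (j ℕ.+ t)
    lemma = ℕsolve-∀
    upper : k₋₁ ℕ.* q ℕ.+ (A ℕ.+ suc j) ℕ.+ (m ∸ j) ≡ N A m q
    upper = trans (lemma (k₋₁ ℕ.* q) A j (m ∸ j)) (cong (λ t → k₋₁ ℕ.* q ℕ.+ A ℕ.+ suc t) (ℕₚ.m+[n∸m]≡n j≤m))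
    swap : ∀ m j q → (m - j) - q ≡ (m - q) - j
    swap = solve-∀
    lower : + (m ∸ j) - + q ≡ (+ m - + q) - + j
    lower = trans (cong (_- + q) (sym (+m-+n≡+[m∸n] j≤m))) (swap (+ m) (+ j) (+ q))

  -- The two Vandermonde convolutions leave these terms behind; they telescope away.
  boundary : ℕ → ℕ → ℤ
  boundary m q = binomℤ (+ (k₋₁ ℕ.* q ℕ.+ m)) (+ m - + q + + 1)

  +[a*b+c] : ∀ a b c → + (a ℕ.* b ℕ.+ c) ≡ + a * + b + + c
  +[a*b+c] a b c = trans (ℤₚ.pos-+ (a ℕ.* b) c) (cong (_+ + c) (ℤₚ.pos-* a b))

  vandermonde-α₁ : ∀ A m q →
    ∑ (suc m) (λ j → binom (α₁ A) j * binomℤ (+ N A m q) ((+ m - + q) - + j)) ≡ boundary m (suc q)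
  vandermonde-α₁ A m q =
    trans (vandermonde (N A m q) (α₁ A) (suc m) (+ m - + q) range) (cong₂ binomℤ upper lower)
    where
    range : + m - + q ℤ.< + suc m
    range = ℤₚ.≤-<-trans (ℤₚ.i-j≤i (+ m) (+ q)) (ℤ.+<+ (ℕₚ.n<1+n m))
    upper-lemma : ∀ K q A m → (- (A + + 1 - (+ 1 + K)) - + 1) + (K * q + A + (+ 1 + m)) ≡ K * (+ 1 + q) + m
    upper-lemma = solve-∀
    upper : α₁ A + + N A m q ≡ + (k₋₁ ℕ.* suc q ℕ.+ m)
    upper rewrite +N A m q | +[a*b+c] k₋₁ (suc q) m = upper-lemma (+ k₋₁) (+ q) (+ A) (+ m)
    lower-lemma : ∀ m q → m - q ≡ m - (+ 1 + q) + + 1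
    lower-lemma = solve-∀
    lower : + m - + q ≡ + m - + suc q + + 1
    lower = lower-lemma (+ m) (+ q)

  vandermonde-α₂ : ∀ A m q →
    ∑ (suc m) (λ j → binom (α₂ A) (suc j) * binomℤ (+ N A m q) ((+ m - + q) - + j)) ≡
    boundary m q - coeff A (suc m) q
  vandermonde-α₂ A m q = begin
    ∑ (suc m) (λ j → binom (α₂ A) (suc j) * binomℤ (+ N A m q) (n - + j))
      ≡⟨ ∑-cong (suc m) (λ j → cong (λ t → binom (α₂ A) (suc j) * binomℤ (+ N A m q) t) (shift n (+ j))) ⟩
    ∑ (suc m) (λ j → G (suc j))                        ≡⟨ add-subtract (G 0) _ ⟩
    G 0 + ∑ (suc m) (λ j → G (suc j)) - G 0             ≡⟨ cong₂ _-_ (sym (∑-shift (suc m) G)) G₀ ⟩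
    ∑ (suc (suc m)) G - binomℤ (+ N A m q) (n + + 1)
      ≡⟨ cong (_- binomℤ (+ N A m q) (n + + 1)) (vandermonde (N A m q) (α₂ A) (suc (suc m)) (n + + 1) range) ⟩
    binomℤ (α₂ A + + N A m q) (n + + 1) - binomℤ (+ N A m q) (n + + 1)
      ≡⟨ cong₂ (λ a t → binomℤ a (n + + 1) - binomℤ (+ N A m q) t) upper (lower (+ m) (+ q)) ⟩
    boundary m q - coeff A (suc m) q ∎
    where
    n = + m - + q
    G : ℕ → ℤ
    G i = binom (α₂ A) i * binomℤ (+ N A m q) ((n + + 1) - + i)
    shift : ∀ n j → n - j ≡ (n + + 1) - (+ 1 + j)
    shift = solve-∀
    add-subtract : ∀ a b → b ≡ a + b - a
    add-subtract = solve-∀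
    G₀ : G 0 ≡ binomℤ (+ N A m q) (n + + 1)
    G₀ = trans (ℤₚ.*-identityˡ _) (cong (binomℤ (+ N A m q)) (ℤₚ.+-identityʳ (n + + 1)))
    range : n + + 1 ℤ.< + suc (suc m)
    range = ℤₚ.≤-<-trans (ℤₚ.+-monoˡ-≤ (+ 1) (ℤₚ.i-j≤i (+ m) (+ q)))
                         (ℤ.+<+ (s≤s (ℕₚ.≤-reflexive (ℕₚ.+-comm m 1))))
    upper-lemma : ∀ K q A m → (- A - + 1) + (K * q + A + (+ 1 + m)) ≡ K * q + m
    upper-lemma = solve-∀
    upper : α₂ A + + N A m q ≡ + (k₋₁ ℕ.* q ℕ.+ m)
    upper rewrite +N A m q | +[a*b+c] k₋₁ q m = upper-lemma (+ k₋₁) (+ q) (+ A) (+ m)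
    lower : ∀ m q → m - q + + 1 ≡ (+ 1 + m) - q
    lower = solve-∀

  boundary-0 : ∀ m → boundary m 0 ≡ + 0
  boundary-0 m = trans (cong₂ binomℤ (cong (λ t → + (t ℕ.+ m)) (ℕₚ.*-zeroʳ k₋₁)) (lemma (+ m)))
                       (binom-< m (suc m) ℕₚ.≤-refl)
    where lemma : ∀ m → m - + 0 + + 1 ≡ + 1 + m
          lemma = solve-∀

  boundary-2+m : ∀ m → boundary m (suc (suc m)) ≡ + 0
  boundary-2+m m = trans (cong (binomℤ _) (lemma (+ m))) (binomℤ-+m-+n _ (ℕₚ.n<1+n m))
    where lemma : ∀ m → m - (+ 1 + (+ 1 + m)) + + 1 ≡ m - (+ 1 + m)
          lemma = solve-∀

  coeff-reverse : ∀ A n j → j ≤ n → coeff A n (n ∸ j) ≡ binom (+ (k ℕ.* n ℕ.+ A) - + (k₋₁ ℕ.* j)) j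
  coeff-reverse A n j j≤n = cong₂ binomℤ upper lower
    where
    lower : + n - + (n ∸ j) ≡ + j
    lower = trans (+m-+n≡+[m∸n] (ℕₚ.m∸n≤m n j)) (cong +_ (ℕₚ.m∸[m∸n]≡n j≤n))
    lemma : ∀ K n j A → K * (n - j) + A + n ≡ (+ 1 + K) * n + A - K * j
    lemma = solve-∀
    upper : + (k₋₁ ℕ.* (n ∸ j) ℕ.+ A ℕ.+ n) ≡ + (k ℕ.* n ℕ.+ A) - + (k₋₁ ℕ.* j)
    upper = begin
      + (k₋₁ ℕ.* (n ∸ j) ℕ.+ A ℕ.+ n)    ≡⟨ ℤₚ.pos-+ (k₋₁ ℕ.* (n ∸ j) ℕ.+ A) n ⟩
      + (k₋₁ ℕ.* (n ∸ j) ℕ.+ A) + + n    ≡⟨ cong (_+ + n) (+[a*b+c] k₋₁ (n ∸ j) A) ⟩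
      + k₋₁ * + (n ∸ j) + + A + + n      ≡⟨ cong (λ t → + k₋₁ * t + + A + + n) (+m-+n≡+[m∸n] j≤n) ⟨
      + k₋₁ * (+ n - + j) + + A + + n    ≡⟨ lemma (+ k₋₁) (+ n) (+ j) (+ A) ⟩
      + k * + n + + A - + k₋₁ * + j      ≡⟨ cong₂ _-_ (+[a*b+c] k n A) (ℤₚ.pos-* k₋₁ j) ⟨
      + (k ℕ.* n ℕ.+ A) - + (k₋₁ ℕ.* j)  ∎

module Expansion {c ℓ} (R : CommutativeRing c ℓ) (k₋₁ r : ℕ) (x : CommutativeRing.Carrier R) where

  open CommutativeRing R hiding (zero)
  open RingFacts R
  open RingSolver using (solve; _:=_; _:+_; _:*_; _:-_)
  open Binomial using (signℤ)
  open import Relation.Binary.Reasoning.Setoid setoid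
  open Coefficients k₋₁
  open import Data.Nat.Tactic.RingSolver using () renaming (solve-∀ to ℕsolve-∀)
  open import Algebra.Properties.CommutativeSemigroup *-commutativeSemigroup using (x∙yz≈y∙xz)

  y : Carrier
  y = pow R x k

  -- Definitionally the entry of Bmat, so that det n (Bmat k r n x) is minorDet 0 n.
  entry : ℕ → ℕ → Carrier
  entry i j = fromℤ R (binomℤ (+ i ℤ.- + k ℤ.+ + 1 ℤ.+ + r) (+ i ℤ.- + j)) * y
            + fromℤ R (binomℤ (+ i ℤ.+ + 1 ℤ.+ + r) (+ i ℤ.- + j ℤ.+ + 1))

  entry-superdiagonal : ∀ i → entry i (suc i) ≈ 1#
  entry-superdiagonal i
    rewrite ≡.cong (λ t → + i ℤ.- + t) (ℕₚ.+-comm 1 i) | +m-+[m+1+n]≡-[1+n] i 0 =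
    trans (+-cong (zeroˡ y) (+-identityʳ 1#)) (+-identityˡ 1#)

  entry-above : ∀ i t → entry i (i ℕ.+ suc (suc t)) ≈ 0#
  entry-above i t rewrite +m-+[m+1+n]≡-[1+n] i (suc t) = trans (+-congʳ (zeroˡ y)) (+-identityˡ 0#)

  open Hessenberg R entry entry-superdiagonal entry-above

  poly : ℕ → ℕ → Carrier
  poly A m = ∑ (suc m) (λ q → fromℤ R (coeff A m q) * pow R y q)

  poly-extend : ∀ A m M → suc m ≤ M → ∑ M (λ q → fromℤ R (coeff A m q) * pow R y q) ≈ poly A m
  poly-extend A m M 1+m≤M = ∑-extend (suc m) M _ 1+m≤M (λ q m<q →
    trans (*-congʳ (reflexive (≡.cong (fromℤ R) (binomℤ-+m-+n _ m<q)))) (zeroˡ _))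

  column-entry : ∀ s j → sign R j * entry (s ℕ.+ j) s ≈
    fromℤ R (binom (α₁ (s ℕ.+ r)) j) * y - fromℤ R (binom (α₂ (s ℕ.+ r)) (suc j))
  column-entry s j rewrite +[m+n]-+m≡+n s j | ℕₚ.+-comm j 1 = begin
    sign R j * (fromℤ R b₁ * y + fromℤ R b₂)
      ≈⟨ *-cong (fromℤ-sign j) refl ⟩
    fromℤ R σ * (fromℤ R b₁ * y + fromℤ R b₂)
      ≈⟨ solve 4 (λ σ b₁ y b₂ → σ :* (b₁ :* y :+ b₂) := σ :* b₁ :* y :+ σ :* b₂) refl _ _ _ _ ⟩
    fromℤ R σ * fromℤ R b₁ * y + fromℤ R σ * fromℤ R b₂
      ≈⟨ +-cong (*-congʳ (sym (fromℤ-* σ b₁))) (sym (fromℤ-* σ b₂)) ⟩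
    fromℤ R (σ ℤ.* b₁) * y + fromℤ R (σ ℤ.* b₂)
      ≡⟨ ≡.cong₂ (λ u v → fromℤ R u * y + fromℤ R v) (sign*binom-entry₁ r s j) (sign*binom-entry₂ r s j) ⟩
    fromℤ R (binom (α₁ A) j) * y + fromℤ R (ℤ.- binom (α₂ A) (suc j))
      ≈⟨ +-congˡ (fromℤ-neg (binom (α₂ A) (suc j))) ⟩
    fromℤ R (binom (α₁ A) j) * y - fromℤ R (binom (α₂ A) (suc j)) ∎
    where
    A = s ℕ.+ r
    σ = signℤ j
    b₁ = binom (+ (s ℕ.+ j) ℤ.- + k ℤ.+ + 1 ℤ.+ + r) j
    b₂ = binom (+ (s ℕ.+ j) ℤ.+ + 1 ℤ.+ + r) (suc j)

  module Step (s m : ℕ) where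

    A = s ℕ.+ r

    C : ℕ → ℕ → ℤ
    C j q = binomℤ (+ N A m q) ((+ m ℤ.- + q) ℤ.- + j)

    T : ℕ → ℕ → Carrier
    T j q = fromℤ R (binom (α₁ A) j ℤ.* C j q) * pow R y (suc q)
          - fromℤ R (binom (α₂ A) (suc j) ℤ.* C j q) * pow R y q

    column-term : ∀ j → j ≤ m → minorDet (suc (s ℕ.+ j)) (m ∸ j) ≈ poly (suc (s ℕ.+ j) ℕ.+ r) (m ∸ j) →
                  sign R j * (entry (s ℕ.+ j) s * minorDet (suc (s ℕ.+ j)) (m ∸ j)) ≈ ∑ (suc (suc m)) (T j)
    column-term j j≤m IH = begin
      sign R j * (entry (s ℕ.+ j) s * minorDet (suc (s ℕ.+ j)) (m ∸ j))
        ≈⟨ *-assoc _ _ _ ⟨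
      sign R j * entry (s ℕ.+ j) s * minorDet (suc (s ℕ.+ j)) (m ∸ j)
        ≈⟨ *-cong (column-entry s j) (trans IH (reflexive (≡.cong (λ a → poly a (m ∸ j)) index))) ⟩
      (B₁ * y - B₂) * poly (A ℕ.+ suc j) (m ∸ j)
        ≈⟨ *-congˡ (poly-extend (A ℕ.+ suc j) (m ∸ j) (suc (suc m)) (s≤s (ℕₚ.m≤n⇒m≤1+n (ℕₚ.m∸n≤m m j)))) ⟨
      (B₁ * y - B₂) * ∑ (suc (suc m)) (λ q → fromℤ R (coeff (A ℕ.+ suc j) (m ∸ j) q) * pow R y q)
        ≈⟨ *-distribˡ-∑ (suc (suc m)) _ _ ⟩
      ∑ (suc (suc m)) (λ q → (B₁ * y - B₂) * (fromℤ R (coeff (A ℕ.+ suc j) (m ∸ j) q) * pow R y q))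
        ≈⟨ ∑-cong (suc (suc m)) term ⟩
      ∑ (suc (suc m)) (T j) ∎
      where
      B₁ = fromℤ R (binom (α₁ A) j)
      B₂ = fromℤ R (binom (α₂ A) (suc j))
      index-lemma : ∀ s j r → suc (s ℕ.+ j) ℕ.+ r ≡ s ℕ.+ r ℕ.+ suc j
      index-lemma = ℕsolve-∀
      index : suc (s ℕ.+ j) ℕ.+ r ≡ A ℕ.+ suc j
      index = index-lemma s j r
      term : ∀ q → (B₁ * y - B₂) * (fromℤ R (coeff (A ℕ.+ suc j) (m ∸ j) q) * pow R y q) ≈ T j q
      term q rewrite coeff-shift A m j q j≤m = begin
        (B₁ * y - B₂) * (fromℤ R (C j q) * pow R y q)
          ≈⟨ solve 5 (λ b₁ y b₂ c Y → (b₁ :* y :- b₂) :* (c :* Y) := b₁ :* c :* (y :* Y) :- b₂ :* c :* Y)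
                     refl _ _ _ _ _ ⟩
        B₁ * fromℤ R (C j q) * (y * pow R y q) - B₂ * fromℤ R (C j q) * pow R y q
          ≈⟨ +-cong (*-congʳ (fromℤ-* (binom (α₁ A) j) (C j q)))
                    (-‿cong (*-congʳ (fromℤ-* (binom (α₂ A) (suc j)) (C j q)))) ⟨
        T j q ∎

    γ κ : ℕ → Carrier
    γ q = fromℤ R (boundary m q) * pow R y q
    κ q = fromℤ R (coeff A (suc m) q) * pow R y q

    row-sum : ∀ q → ∑ (suc m) (λ j → T j q) ≈ γ (suc q) - (γ q - κ q)
    row-sum q = begin
      ∑ (suc m) (λ j → T j q)
        ≈⟨ ∑-distrib-- (suc m) _ _ ⟩
      ∑ (suc m) (λ j → fromℤ R (u j) * pow R y (suc q)) - ∑ (suc m) (λ j → fromℤ R (v j) * pow R y q)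
        ≈⟨ +-cong (*-distribʳ-∑ (suc m) _ _) (-‿cong (*-distribʳ-∑ (suc m) _ _)) ⟨
      ∑ (suc m) (λ j → fromℤ R (u j)) * pow R y (suc q) - ∑ (suc m) (λ j → fromℤ R (v j)) * pow R y q
        ≈⟨ +-cong (*-congʳ (fromℤ-∑ (suc m) u)) (-‿cong (*-congʳ (fromℤ-∑ (suc m) v))) ⟨
      fromℤ R (sumℕ ℤₚ.+-*-commutativeRing (suc m) u) * pow R y (suc q)
        - fromℤ R (sumℕ ℤₚ.+-*-commutativeRing (suc m) v) * pow R y q
        ≡⟨ ≡.cong₂ (λ U V → fromℤ R U * pow R y (suc q) - fromℤ R V * pow R y q)
                   (vandermonde-α₁ A m q) (vandermonde-α₂ A m q) ⟩
      γ (suc q) - fromℤ R (boundary m q ℤ.- coeff A (suc m) q) * pow R y q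
        ≈⟨ +-congˡ (-‿cong (*-congʳ
             (trans (fromℤ-+ (boundary m q) _) (+-congˡ (fromℤ-neg (coeff A (suc m) q)))))) ⟩
      γ (suc q) - (fromℤ R (boundary m q) - fromℤ R (coeff A (suc m) q)) * pow R y q
        ≈⟨ solve 4 (λ a′ G K Y → a′ :- (G :- K) :* Y := a′ :- (G :* Y :- K :* Y)) refl _ _ _ _ ⟩
      γ (suc q) - (γ q - κ q) ∎
      where
      u v : ℕ → ℤ
      u j = binom (α₁ A) j ℤ.* C j q
      v j = binom (α₂ A) (suc j) ℤ.* C j q

    telescope : ∑ (suc (suc m)) (λ q → γ (suc q) - (γ q - κ q)) ≈ poly A (suc m)
    telescope = begin
      ∑ (suc (suc m)) (λ q → γ (suc q) - (γ q - κ q))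
        ≈⟨ ∑-cong (suc (suc m)) (λ q →
             solve 3 (λ γ₁ γ₀ κ → γ₁ :- (γ₀ :- κ) := (γ₁ :- γ₀) :+ κ) refl (γ (suc q)) (γ q) (κ q)) ⟩
      ∑ (suc (suc m)) (λ q → (γ (suc q) - γ q) + κ q)
        ≈⟨ ∑-distrib-+ (suc (suc m)) _ κ ⟩
      ∑ (suc (suc m)) (λ q → γ (suc q) - γ q) + poly A (suc m)
        ≈⟨ +-congʳ (∑-telescope (suc (suc m)) γ) ⟩
      (γ (suc (suc m)) - γ 0) + poly A (suc m)
        ≈⟨ +-congʳ (+-cong (vanish (suc (suc m)) (boundary-2+m m)) (-‿cong (vanish 0 (boundary-0 m)))) ⟩
      (0# - 0#) + poly A (suc m)
        ≈⟨ trans (+-congʳ (-‿inverseʳ 0#)) (+-identityˡ _) ⟩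
      poly A (suc m) ∎
      where
      vanish : ∀ q → boundary m q ≡ + 0 → γ q ≈ 0#
      vanish q boundary≡0 = trans (*-congʳ (reflexive (≡.cong (fromℤ R) boundary≡0))) (zeroˡ _)

  minorDet-step : ∀ s m →
    (∀ j → j ≤ m → minorDet (suc (s ℕ.+ j)) (m ∸ j) ≈ poly (suc (s ℕ.+ j) ℕ.+ r) (m ∸ j)) →
    minorDet s (suc m) ≈ poly (s ℕ.+ r) (suc m)
  minorDet-step s m IH = begin
    minorDet s (suc m)
      ≈⟨ det-minor-expansion m s ⟩
    ∑ (suc m) (λ j → sign R j * (entry (s ℕ.+ j) s * minorDet (suc (s ℕ.+ j)) (m ∸ j)))
      ≈⟨ ∑-cong-< (suc m) (λ { j (s≤s j≤m) → column-term j j≤m (IH j j≤m) }) ⟩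
    ∑ (suc m) (λ j → ∑ (suc (suc m)) (T j))
      ≈⟨ ∑-comm (suc m) (suc (suc m)) T ⟩
    ∑ (suc (suc m)) (λ q → ∑ (suc m) (λ j → T j q))
      ≈⟨ ∑-cong (suc (suc m)) row-sum ⟩
    ∑ (suc (suc m)) (λ q → γ (suc q) - (γ q - κ q))
      ≈⟨ telescope ⟩
    poly (s ℕ.+ r) (suc m) ∎
    where open Step s m

  minorDet≈poly : ∀ m s → minorDet s m ≈ poly (s ℕ.+ r) m
  minorDet≈poly = <-rec _ step
    where
    step : ∀ m → (∀ {m′} → m′ < m → ∀ s → minorDet s m′ ≈ poly (s ℕ.+ r) m′) →
           ∀ s → minorDet s m ≈ poly (s ℕ.+ r) m
    step zero    _   s = sym (trans (+-identityˡ _) (trans (*-identityʳ _) (+-identityʳ 1#)))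
    step (suc m) rec s = minorDet-step s m (λ j _ → rec (s≤s (ℕₚ.m∸n≤m m j)) (suc (s ℕ.+ j)))

  pow-x^r*y^[n∸j] : ∀ n j → j ≤ n → pow R x r * pow R y (n ∸ j) ≈ pow R x (k ℕ.* n ℕ.+ r ∸ k ℕ.* j)
  pow-x^r*y^[n∸j] n j j≤n = begin
    pow R x r * pow R y (n ∸ j)            ≈⟨ *-congˡ (pow-* x k (n ∸ j)) ⟨
    pow R x r * pow R x (k ℕ.* (n ∸ j))    ≈⟨ pow-+ x r (k ℕ.* (n ∸ j)) ⟨
    pow R x (r ℕ.+ k ℕ.* (n ∸ j))          ≡⟨ ≡.cong (pow R x) exponent ⟩
    pow R x (k ℕ.* n ℕ.+ r ∸ k ℕ.* j)      ∎
    where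
    exponent : r ℕ.+ k ℕ.* (n ∸ j) ≡ k ℕ.* n ℕ.+ r ∸ k ℕ.* j
    exponent = ≡.trans (≡.cong (r ℕ.+_) (ℕₚ.*-distribˡ-∸ k n j))
      (≡.trans (ℕₚ.+-comm r _) (≡.sym (ℕₚ.+-∸-comm r (ℕₚ.*-monoʳ-≤ k j≤n))))

  [kn+r]/k≡n : ∀ n → r < k → (k ℕ.* n ℕ.+ r) ℕ./ k ≡ n
  [kn+r]/k≡n n r<k = ≡.trans (ℕ.+-distrib-/-∣ˡ r (ℕ∣.m∣m*n n))
    (≡.trans (≡.cong₂ ℕ._+_ (≡.trans (≡.cong (ℕ._/ k) (ℕₚ.*-comm k n)) (ℕ.m*n/n≡m n k)) (ℕ.m<n⇒m/n≡0 r<k))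
             (ℕₚ.+-identityʳ n))

  x^r*poly≈fib : ∀ n → r < k → pow R x r * poly r n ≈ fib R k (k ℕ.* n ℕ.+ r) x
  x^r*poly≈fib n r<k = begin
    pow R x r * poly r n
      ≈⟨ *-congˡ (∑-reverse (suc n) _) ⟩
    pow R x r * ∑ (suc n) (λ j → fromℤ R (coeff r n (n ∸ j)) * pow R y (n ∸ j))
      ≈⟨ *-distribˡ-∑ (suc n) _ _ ⟩
    ∑ (suc n) (λ j → pow R x r * (fromℤ R (coeff r n (n ∸ j)) * pow R y (n ∸ j)))
      ≈⟨ ∑-cong-< (suc n) (λ { j (s≤s j≤n) → term j j≤n }) ⟩
    ∑ (suc n) fib-term
      ≡⟨ ≡.cong (λ t → ∑ (suc t) fib-term) ([kn+r]/k≡n n r<k) ⟨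
    fib R k (k ℕ.* n ℕ.+ r) x ∎
    where
    fib-term : ℕ → Carrier
    fib-term j = fromℤ R (binom (+ (k ℕ.* n ℕ.+ r) ℤ.- + (k₋₁ ℕ.* j)) j) * pow R x (k ℕ.* n ℕ.+ r ∸ k ℕ.* j)
    term : ∀ j → j ≤ n → pow R x r * (fromℤ R (coeff r n (n ∸ j)) * pow R y (n ∸ j)) ≈ fib-term j
    term j j≤n = trans (x∙yz≈y∙xz _ _ _)
      (*-cong (reflexive (≡.cong (fromℤ R) (coeff-reverse r n j j≤n))) (pow-x^r*y^[n∸j] n j j≤n))


open import Data.Nat using (_+_; _*_; NonZero)

theorem2 : {c ℓ : Level} (R : CommutativeRing c ℓ) (k r n : ℕ) .{{_ : NonZero k}} →
    1 ≤ k → r < k → (x : CommutativeRing.Carrier R) →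
    CommutativeRing._≈_ R
      (CommutativeRing._*_ R (pow R x r) (det R n (Bmat R k r n x)))
      (fib R k (k * n + r) x)
theorem2 R (suc k₋₁) r n _ r<k x = trans (*-congˡ (minorDet≈poly n 0)) (x^r*poly≈fib n r<k)
  where
  open CommutativeRing R using (trans; *-congˡ)
  open Expansion R k₋₁ r x
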